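{- In the sparse incremental cycle-detection algorithm described in the context, run for $m$ arc insertions on an $n$-vertex graph, no vertex is ever assigned an index less than $-nm-n$.
   Context: Setting: a directed graph on a fixed set of $n>1$ vertices, initially with no arcs, grows by on-line insertion of arcs; no loops and no multiple arcs are ever inserted; the total number $m$ of insertions is known in advance, with $m=\Omega(n)$. Pairs are ordered lexicographically: $(a,b)<(c,d)$ iff $a<c$, or $a=c$ and $b<d$. Let $\Delta=\min\{m^{1/2},n^{2/3}\}$. Data: each vertex $x$ has a level $k(x)$ (positive integer, initially $1$) and an index $i(x)$ (negative integer; initially the indices are distinct integers in $\{ -n,\dots,-1\}$). A global variable $\mathit{index}$ is initially $-n$. Each vertex $x$ has a set $\mathit{out}(x)$ of outgoing arcs and a set $\mathit{in}(x)$ of incoming arcs, both initially empty. Vertices can be marked; initially none are. Insertion of arc $(v,w)$: Step 1: If $(k(v),i(v))<(k(w),i(w))$, go to Step 5. Step 2 (backward search): Let $B$ and $F$ be empty lists and $\mathit{arcs}\gets 0$. Call $\mathrm{Bvisit}(v)$, where $\mathrm{Bvisit}(y)$: mark $y$; for each $(x,y)\in \mathit{in}(y)$ call $\mathrm{Btraverse}(x,y)$; then append $y$ to the end of $B$. $\mathrm{Btraverse}(x,y)$: if $x=w$, stop the whole algorithm and report a cycle; $\mathit{arcs}\gets\mathit{arcs}+1$; if $\mathit{arcs}\ge\Delta$, abort the backward search: set $k(w)\gets k(v)+1$, $\mathit{in}(w)\gets\emptyset$, $B\gets[\,]$, unmark all marked vertices, and go to Step 3; otherwise, if $x$ is unmarked,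 call $\mathrm{Bvisit}(x)$. If the backward search ends without reporting a cycle and without being aborted: if $k(w)=k(v)$ go to Step 4; otherwise set $k(w)\gets k(v)$, $\mathit{in}(w)\gets\emptyset$ and continue with Step 3. Step 3 (forward search): Call $\mathrm{Fvisit}(w)$, where $\mathrm{Fvisit}(x)$: for each $(x,y)\in\mathit{out}(x)$ call $\mathrm{Ftraverse}(x,y)$; then put $x$ at the front of $F$. $\mathrm{Ftraverse}(x,y)$: if $y=v$ or $y$ is in $B$, stop the whole algorithm and report a cycle; if $k(y)<k(w)$, set $k(y)\gets k(w)$, $\mathit{in}(y)\gets\emptyset$, and call $\mathrm{Fvisit}(y)$; afterwards, if $k(y)=k(w)$, add $(x,y)$ to $\mathit{in}(y)$. Step 4 (re-index): Let $L$ be the concatenation of $B$ followed by $F$. While $L$ is nonempty: $\mathit{index}\gets\mathit{index}-1$, delete the last vertex $x$ of $L$, and set $i(x)\gets\mathit{index}$. Step 5: Add $(v,w)$ to $\mathit{out}(v)$; if $k(v)=k(w)$, add $(v,w)$ to $\mathit{in}(w)$. Once a cycle is reported, the algorithm stops and processes no further insertions. -}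

module Defs where

open import Data.Nat as ℕ using (ℕ; zero; suc; _+_; _*_; _≤_; _<_)
open import Data.Integer as ℤ using (ℤ; +_)
open import Data.Fin using (Fin)
open import Data.Fin.Properties using (_≟_)
open import Data.Bool using (Bool; true; false; if_then_else_)
open import Data.List using (List; []; _∷_; _++_; [_]; reverse)
open import Data.Bool.ListAction using (any)
open import Data.List.Membership.Propositional using (_∈_)
open import Data.List.Relation.Binary.Permutation.Propositional using (_↭_)
open import Data.Product using (_×_; _,_)
open import Data.Sum using (_⊎_)
open import Relation.Nullary using (¬_; does)
open import Relation.Binary.PropositionalEquality using (_≡_; _≢_)

upd : ∀ {n} {A : Set} → (Fin n → A) → Fin n → A → Fin n → A
upd f a b x = if does (x ≟ a) then b else f x

addTo : ∀ {n} → Fin n → List (Fin n) → List (Fin n)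
addTo a xs = if any (λ y → does (y ≟ a)) xs then xs else xs ++ [ a ]

_<lex_ : ℕ × ℤ → ℕ × ℤ → Set
(a , b) <lex (c , d) = a < c ⊎ (a ≡ c × b ℤ.< d)

-- Global state of the algorithm.
--   lvl x    = k(x)
--   idx x    = i(x)
--   index    = the global variable index
--   out x    = { y | (x,y) ∈ out(x) }
--   inn y    = { x | (x,y) ∈ in(y) }
--   marked   = marks
--   B, F     = the lists B and F
--   arcs     = the counter arcs
--   log      = ghost variable: every index value ever assigned in Step 4,
--              in order of assignment
record Config (n : ℕ) : Set where
  field
    lvl    : Fin n → ℕ
    idx    : Fin n → ℤ
    index  : ℤ
    out    : Fin n → List (Fin n)
    inn    : Fin n → List (Fin n)
    marked : Fin n → Bool
    B      : List (Fin n)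
    F      : List (Fin n)
    arcs   : ℕ
    log    : List ℤ
open Config public

initConfig : (n : ℕ) → (Fin n → ℤ) → Config n
initConfig n i0 = record
  { lvl = λ _ → 1 ; idx = i0 ; index = ℤ.- (+ n)
  ; out = λ _ → [] ; inn = λ _ → [] ; marked = λ _ → false
  ; B = [] ; F = [] ; arcs = 0 ; log = [] }

-- arcs ≥ Δ = min{ m^{1/2} , n^{2/3} }  ⇔  arcs² ≥ m  or  arcs³ ≥ n²
ReachedΔ : ℕ → ℕ → ℕ → Set
ReachedΔ n m a = (m ≤ a * a) ⊎ (n * n ≤ a * a * a)

module Algorithm (n m : ℕ) where

  data BRes : Set where
    bok    : Config n → BRes
    babort : Config n → BRes
    bcycle : BRes

  data FRes : Set where
    fok    : Config n → FRes
    fcycle : FRes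

  data IRes : Set where
    done  : Config n → IRes
    cycle : IRes

  -- Step 4 (re-index), applied to the reverse of L, i.e. last vertex first.
  reindexRev : List (Fin n) → Config n → Config n
  reindexRev [] c = c
  reindexRev (x ∷ xs) c =
    let j = index c ℤ.- + 1 in
    reindexRev xs (record c { index = j ; idx = upd (idx c) x j ; log = log c ++ [ j ] })

  step4 : Config n → Config n
  step4 c = reindexRev (reverse (B c ++ F c)) c

  module Insertion (v w : Fin n) where

    mark : Config n → Fin n → Config n
    mark c y = record c { marked = upd (marked c) y true }

    appendB : Config n → Fin n → Config n
    appendB c y = record c { B = B c ++ [ y ] }

    incArcs : Config n → Config n
    incArcs c = record c { arcs = suc (arcs c) }

    abortCfg : Config n → Config n
    abortCfg c = record c
      { lvl = upd (lvl c) w (suc (lvl c v)) ; inn = upd (inn c) w []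
      ; B = [] ; marked = λ _ → false }

    -- Backward search.  Iteration over in(y) is in an arbitrary order
    -- (any permutation of the stored set).
    mutual
      data Bvisit : Config n → Fin n → BRes → Set where
        bvisit-ok    : ∀ {c y xs c'} → xs ↭ inn c y →
                       Blist (mark c y) y xs (bok c') → Bvisit c y (bok (appendB c' y))
        bvisit-abort : ∀ {c y xs c'} → xs ↭ inn c y →
                       Blist (mark c y) y xs (babort c') → Bvisit c y (babort c')
        bvisit-cycle : ∀ {c y xs} → xs ↭ inn c y →
                       Blist (mark c y) y xs bcycle → Bvisit c y bcycle

      data Blist : Config n → Fin n → List (Fin n) → BRes → Set where
        blist-nil   : ∀ {c y} → Blist c y [] (bok c)
        blist-ok    : ∀ {c y x xs c' r} → Btraverse c x y (bok c') →
                      Blist c' y xs r → Blist c y (x ∷ xs) r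
        blist-abort : ∀ {c y x xs c'} → Btraverse c x y (babort c') →
                      Blist c y (x ∷ xs) (babort c')
        blist-cycle : ∀ {c y x xs} → Btraverse c x y bcycle →
                      Blist c y (x ∷ xs) bcycle

      data Btraverse : Config n → Fin n → Fin n → BRes → Set where
        btrav-cycle   : ∀ {c x y} → x ≡ w → Btraverse c x y bcycle
        btrav-abort   : ∀ {c x y} → x ≢ w → ReachedΔ n m (arcs (incArcs c)) →
                        Btraverse c x y (babort (abortCfg (incArcs c)))
        btrav-marked  : ∀ {c x y} → x ≢ w → ¬ ReachedΔ n m (arcs (incArcs c)) →
                        marked c x ≡ true → Btraverse c x y (bok (incArcs c))
        btrav-visit   : ∀ {c x y r} → x ≢ w → ¬ ReachedΔ n m (arcs (incArcs c)) →
                        marked c x ≡ false → Bvisit (incArcs c) x r → Btraverse c x y r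

    raise : Config n → Fin n → Config n
    raise c y = record c { lvl = upd (lvl c) y (lvl c w) ; inn = upd (inn c) y [] }

    addIn : Config n → Fin n → Fin n → Config n
    addIn c x y = if does (lvl c y ℕ.≟ lvl c w)
                  then record c { inn = upd (inn c) y (addTo x (inn c y)) }
                  else c

    pushF : Config n → Fin n → Config n
    pushF c x = record c { F = x ∷ F c }

    -- Forward search.  Iteration over out(x) is in an arbitrary order.
    mutual
      data Fvisit : Config n → Fin n → FRes → Set where
        fvisit-ok    : ∀ {c x ys c'} → ys ↭ out c x →
                       Flist c x ys (fok c') → Fvisit c x (fok (pushF c' x))
        fvisit-cycle : ∀ {c x ys} → ys ↭ out c x →
                       Flist c x ys fcycle → Fvisit c x fcycle

      data Flist : Config n → Fin n → List (Fin n) → FRes → Set where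
        flist-nil   : ∀ {c x} → Flist c x [] (fok c)
        flist-ok    : ∀ {c x y ys c' r} → Ftraverse c x y (fok c') →
                      Flist c' x ys r → Flist c x (y ∷ ys) r
        flist-cycle : ∀ {c x y ys} → Ftraverse c x y fcycle →
                      Flist c x (y ∷ ys) fcycle

      data Ftraverse : Config n → Fin n → Fin n → FRes → Set where
        ftrav-cycle     : ∀ {c x y} → (y ≡ v ⊎ y ∈ B c) → Ftraverse c x y fcycle
        ftrav-low-ok    : ∀ {c x y c'} → ¬ (y ≡ v ⊎ y ∈ B c) → lvl c y < lvl c w →
                          Fvisit (raise c y) y (fok c') → Ftraverse c x y (fok (addIn c' x y))
        ftrav-low-cycle : ∀ {c x y} → ¬ (y ≡ v ⊎ y ∈ B c) → lvl c y < lvl c w →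
                          Fvisit (raise c y) y fcycle → Ftraverse c x y fcycle
        ftrav-high      : ∀ {c x y} → ¬ (y ≡ v ⊎ y ∈ B c) → ¬ (lvl c y < lvl c w) →
                          Ftraverse c x y (fok (addIn c x y))

    step5 : Config n → Config n
    step5 c = record c
      { out = upd (out c) v (addTo w (out c v))
      ; inn = if does (lvl c v ℕ.≟ lvl c w) then upd (inn c) w (addTo v (inn c w)) else inn c }

    startSearch : Config n → Config n
    startSearch c = record c { B = [] ; F = [] ; arcs = 0 }

    setLevelW : Config n → Config n
    setLevelW c = record c { lvl = upd (lvl c) w (lvl c v) ; inn = upd (inn c) w [] }

    -- Steps 3, 4, 5 starting from the configuration after Step 2.
    data FromStep3 : Config n → IRes → Set where
      s3-ok    : ∀ {c c'} → Fvisit c w (fok c') → FromStep3 c (done (step5 (step4 c')))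
      s3-cycle : ∀ {c} → Fvisit c w fcycle → FromStep3 c cycle

    data Insert : Config n → IRes → Set where
      step1-skip   : ∀ {c} → (lvl c v , idx c v) <lex (lvl c w , idx c w) →
                     Insert c (done (step5 c))
      step2-cycle  : ∀ {c} → ¬ ((lvl c v , idx c v) <lex (lvl c w , idx c w)) →
                     Bvisit (startSearch c) v bcycle → Insert c cycle
      step2-abort  : ∀ {c c' r} → ¬ ((lvl c v , idx c v) <lex (lvl c w , idx c w)) →
                     Bvisit (startSearch c) v (babort c') → FromStep3 c' r → Insert c r
      step2-same   : ∀ {c c'} → ¬ ((lvl c v , idx c v) <lex (lvl c w , idx c w)) →
                     Bvisit (startSearch c) v (bok c') → lvl c' w ≡ lvl c' v →
                     Insert c (done (step5 (step4 c')))
      step2-differ : ∀ {c c' r} → ¬ ((lvl c v , idx c v) <lex (lvl c w , idx c w)) →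
                     Bvisit (startSearch c) v (bok c') → lvl c' w ≢ lvl c' v →
                     FromStep3 (setLevelW c') r → Insert c r

  open Insertion public using (Insert)

  data Run : Config n → List (Fin n × Fin n) → Config n → Set where
    run-nil   : ∀ {c} → Run c [] c
    run-cycle : ∀ {c v w es} → Insert v w c cycle → Run c ((v , w) ∷ es) c
    run-step  : ∀ {c c' c'' v w es} → Insert v w c (done c') → Run c' es c'' →
                Run c ((v , w) ∷ es) c''

-- The global variable index only ever decreases, and every index ever held by a
-- vertex was a value of it, so index is a lower bound of all indices.  An insertion
-- decreases index by the length of B ++ F.  Marks keep B free of repetitions, the
-- forward search only enters vertices whose level is still below k(w) and lifts
-- them to k(w), so F is free of repetitions, and a vertex of B met by the forward
-- search reports a cycle.  Hence B ++ F has no repetitions, so at most n entries,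
-- and after m insertions index ≥ -n - nm.
module Submission where

open import Defs
open import Data.Nat as ℕ using (ℕ; _<_; _*_; _+_)
import Data.Nat.Properties as ℕ
open import Data.Integer as ℤ using (ℤ; +_; -_; _-_; _≤_)
import Data.Integer.Properties as ℤ
open import Data.Fin using (Fin; zero; suc)
open import Data.Fin.Properties using (_≟_; injective⇒≤)
open import Data.Bool using (true; false)
open import Data.List using (List; []; _∷_; _++_; [_]; length; lookup; reverse)
import Data.List.Properties as List
open import Data.List.Relation.Unary.All as All using (All; []; _∷_)
import Data.List.Relation.Unary.All.Properties as All
open import Data.List.Relation.Unary.AllPairs using ([]; _∷_)
open import Data.List.Relation.Unary.Any using (here; there)
open import Data.List.Relation.Unary.Unique.Propositional using (Unique)
import Data.List.Relation.Unary.Unique.Propositional.Properties as Unique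
open import Data.List.Membership.Propositional using (_∈_; _∉_)
open import Data.List.Membership.Propositional.Properties using (∈-lookup; ∈-++⁻)
open import Data.Product using (_×_; _,_; proj₁; proj₂)
open import Data.Sum using (_⊎_; inj₁; inj₂)
open import Data.Unit using (⊤)
open import Function using (_∘_)
open import Function.Definitions using (Injective)
open import Relation.Nullary using (yes; no; does; contradiction)
open import Relation.Binary.PropositionalEquality hiding ([_])

lookup-injective : ∀ {A : Set} {xs : List A} → Unique xs → Injective _≡_ _≡_ (lookup xs)
lookup-injective {xs = _ ∷ _} _ {zero}  {zero}  _  = refl
lookup-injective (x∉ ∷ _)      {zero}  {suc j} eq = contradiction eq (All.lookup x∉ (∈-lookup j))
lookup-injective (x∉ ∷ _)      {suc i} {zero}  eq = contradiction (sym eq) (All.lookup x∉ (∈-lookup i))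
lookup-injective (_ ∷ u)       {suc i} {suc j} eq = cong suc (lookup-injective u eq)

Unique⇒length≤ : ∀ {n} {xs : List (Fin n)} → Unique xs → length xs ℕ.≤ n
Unique⇒length≤ u = injective⇒≤ (lookup-injective u)

upd-same : ∀ {n} {A : Set} (f : Fin n → A) a b → upd f a b a ≡ b
upd-same f a b with a ≟ a
... | yes _ = refl
... | no a≢a = contradiction refl a≢a

upd-other : ∀ {n} {A : Set} (f : Fin n → A) a b {x} → x ≢ a → upd f a b x ≡ f x
upd-other f a b {x} x≢a with x ≟ a
... | yes x≡a = contradiction x≡a x≢a
... | no _ = refl

i-[j+k]≡i-j-k : ∀ i j k → i - + (j + k) ≡ i - + j - + k
i-[j+k]≡i-j-k i j k = begin
  i - + (j + k)           ≡⟨ cong (λ t → i - t) (ℤ.pos-+ j k) ⟩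
  i - (+ j ℤ.+ + k)       ≡⟨ cong (λ t → i ℤ.+ t) (ℤ.neg-distrib-+ (+ j) (+ k)) ⟩
  i ℤ.+ (- + j ℤ.+ - + k) ≡⟨ sym (ℤ.+-assoc i (- + j) (- + k)) ⟩
  i - + j - + k           ∎
  where open ≡-Reasoning

module _ {n : ℕ} where

  indexing : Config n → ℤ × (Fin n → ℤ) × List ℤ
  indexing c = index c , idx c , log c

  _≤ᵢ_ : ℤ → Config n → Set
  j ≤ᵢ c = (∀ x → j ≤ idx c x) × All (j ≤_) (log c)

  ≤ᵢ-weaken : ∀ {i j} {c : Config n} → i ≤ j → j ≤ᵢ c → i ≤ᵢ c
  ≤ᵢ-weaken i≤j (bound , logged) = (λ x → ℤ.≤-trans i≤j (bound x)) , All.map (ℤ.≤-trans i≤j) logged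

  Floored : Config n → Set
  Floored c = index c ≤ᵢ c

  Floored-indexing : ∀ {c c′ : Config n} → indexing c′ ≡ indexing c → Floored c → Floored c′
  Floored-indexing e = subst (λ (j , f , l) → (∀ x → j ≤ f x) × All (j ≤_) l) (sym e)

module Reindexing (n m : ℕ) where
  open Algorithm n m

  index-reindexRev : ∀ xs c → index (reindexRev xs c) ≡ index c - + length xs
  index-reindexRev []       c = sym (ℤ.+-identityʳ (index c))
  index-reindexRev (x ∷ xs) c = trans (index-reindexRev xs _) (sym (i-[j+k]≡i-j-k (index c) 1 (length xs)))

  Floored-reindexRev : ∀ xs c → Floored c → Floored (reindexRev xs c)
  Floored-reindexRev []       c floored          = floored
  Floored-reindexRev (x ∷ xs) c (bound , logged) =
    Floored-reindexRev xs _ (bound′ , All.++⁺ (All.map (ℤ.≤-trans j≤index) logged) (ℤ.≤-refl ∷ []))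
    where
      j = index c - + 1
      j≤index : j ≤ index c
      j≤index = ℤ.i-j≤i (index c) (+ 1)
      bound′ : ∀ y → j ≤ upd (idx c) x j y
      bound′ y with y ≟ x
      ... | yes _ = ℤ.≤-refl
      ... | no _ = ℤ.≤-trans j≤index (bound y)

  -- c′ is the configuration reaching Step 4 of an insertion started in c.
  record SearchOutcome (c c′ : Config n) : Set where
    constructor _,_
    field
      indexing-same : indexing c′ ≡ indexing c
      B++F-unique   : Unique (B c′ ++ F c′)

  SearchOutcome-trans : ∀ {c c₁ c₂} → indexing c₁ ≡ indexing c → SearchOutcome c₁ c₂ →
                        SearchOutcome c c₂
  SearchOutcome-trans same₁ (same₂ , unique) = trans same₂ same₁ , unique

  step4-floored : ∀ {c c′} → SearchOutcome c c′ → Floored c →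
                  Floored (step4 c′) × index c - + n ≤ index (step4 c′)
  step4-floored {c} {c′} (same , unique) floored =
    Floored-reindexRev L c′ (Floored-indexing {c = c} {c′} same floored) ,
    subst (index c - + n ≤_) (sym index-step4) (ℤ.+-monoʳ-≤ (index c) (ℤ.neg-mono-≤ (ℤ.+≤+ length≤n)))
    where
      L = reverse (B c′ ++ F c′)
      length≤n : length L ℕ.≤ n
      length≤n = subst (ℕ._≤ n) (sym (List.length-reverse (B c′ ++ F c′))) (Unique⇒length≤ unique)
      index-step4 : index (step4 c′) ≡ index c - + length L
      index-step4 = trans (index-reindexRev L c′) (cong (λ j → j - + length L) (cong proj₁ same))

module Search (n m : ℕ) (v w : Fin n) where
  open Algorithm n m
  open Insertion v w hiding (Insert)
  open Reindexing n m

  BackwardFrame : Config n → BRes → Set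
  BackwardFrame c (bok c′)    = indexing c′ ≡ indexing c × F c′ ≡ F c
  BackwardFrame c (babort c′) = indexing c′ ≡ indexing c × F c′ ≡ F c × B c′ ≡ []
  BackwardFrame c bcycle      = ⊤

  BackwardFrame-trans : ∀ {c c′} r → BackwardFrame c (bok c′) → BackwardFrame c′ r → BackwardFrame c r
  BackwardFrame-trans (bok _)    (i , f) (i′ , f′)     = trans i′ i , trans f′ f
  BackwardFrame-trans (babort _) (i , f) (i′ , f′ , b) = trans i′ i , trans f′ f , b
  BackwardFrame-trans bcycle     _       _             = _

  mutual
    Bvisit-frame : ∀ {c y r} → Bvisit c y r → BackwardFrame c r
    Bvisit-frame (bvisit-ok _ l)    = Blist-frame l
    Bvisit-frame (bvisit-abort _ l) = Blist-frame l
    Bvisit-frame (bvisit-cycle _ _) = _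

    Blist-frame : ∀ {c y xs r} → Blist c y xs r → BackwardFrame c r
    Blist-frame blist-nil              = refl , refl
    Blist-frame (blist-ok {r = r} t l) = BackwardFrame-trans r (Btraverse-frame t) (Blist-frame l)
    Blist-frame (blist-abort t)        = Btraverse-frame t
    Blist-frame (blist-cycle _)        = _

    Btraverse-frame : ∀ {c x y r} → Btraverse c x y r → BackwardFrame c r
    Btraverse-frame (btrav-cycle _)               = _
    Btraverse-frame (btrav-abort _ _)             = refl , refl , refl
    Btraverse-frame (btrav-marked _ _ _)          = refl , refl
    Btraverse-frame (btrav-visit {r = r} _ _ _ b) = BackwardFrame-trans r (refl , refl) (Bvisit-frame b)

  BInv : Config n → Set
  BInv c = Unique (B c) × All (λ z → marked c z ≡ true) (B c) × All (_≢ w) (B c)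

  MarksGrow : Config n → Config n → Set
  MarksGrow c c′ = ∀ z → marked c z ≡ true → marked c′ z ≡ true

  NewInB : Config n → Config n → Set
  NewInB c c′ = ∀ {z} → z ∈ B c′ → z ∈ B c ⊎ marked c z ≡ false

  mark-grows : ∀ c y → MarksGrow c (mark c y)
  mark-grows c y z marked-z with z ≟ y
  ... | yes _ = refl
  ... | no _ = marked-z

  unmarked-before : ∀ {c c′ z} → MarksGrow c c′ → marked c′ z ≡ false → marked c z ≡ false
  unmarked-before {c} {z = z} grows unmarked′ with marked c z in eq
  ... | false = refl
  ... | true with trans (sym (grows z eq)) unmarked′
  ...   | ()

  unmarked-∉B : ∀ {c z} → BInv c → marked c z ≡ false → z ∉ B c
  unmarked-∉B (_ , all-marked , _) unmarked z∈B with trans (sym (All.lookup all-marked z∈B)) unmarked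
  ... | ()

  -- Marks survive a completed backward search, so the root v may already be marked;
  -- hence the hypothesis y ∉ B c rather than marked c y ≡ false.
  mutual
    Bvisit-grows : ∀ {c y c′} → Bvisit c y (bok c′) → BInv c → y ∉ B c → y ≢ w →
                   BInv c′ × MarksGrow c c′ ×
                   (∀ {z} → z ∈ B c′ → z ≡ y ⊎ z ∈ B c ⊎ marked c z ≡ false)
    Bvisit-grows {c} {y} (bvisit-ok {c' = c″} _ l) (unique , all-marked , all-≢w) y∉B y≢w
      with Blist-grows l (unique , All.map (λ {z} → mark-grows c y z) all-marked , all-≢w)
    ... | (unique″ , all-marked″ , all-≢w″) , grows , new =
      ( Unique.++⁺ unique″ ([] ∷ []) (λ { (z∈B″ , here refl) → y∉B″ z∈B″ })
      , All.++⁺ all-marked″ (y-marked″ ∷ [])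
      , All.++⁺ all-≢w″ (y≢w ∷ []) )
      , (λ z → grows z ∘ mark-grows c y z) , new′
      where
        y-marked : marked (mark c y) y ≡ true
        y-marked = upd-same (marked c) y true
        y-marked″ : marked c″ y ≡ true
        y-marked″ = grows y y-marked
        y∉B″ : y ∉ B c″
        y∉B″ y∈B″ with new y∈B″
        ... | inj₁ y∈B = y∉B y∈B
        ... | inj₂ unmarked with trans (sym y-marked) unmarked
        ...   | ()
        new′ : ∀ {z} → z ∈ B c″ ++ [ y ] → z ≡ y ⊎ z ∈ B c ⊎ marked c z ≡ false
        new′ z∈ with ∈-++⁻ (B c″) z∈
        ... | inj₂ (here z≡y) = inj₁ z≡y
        ... | inj₁ z∈B″ with new z∈B″
        ...   | inj₁ z∈B = inj₂ (inj₁ z∈B)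
        ...   | inj₂ unmarked = inj₂ (inj₂ (unmarked-before {c} {mark c y} (mark-grows c y) unmarked))

    Blist-grows : ∀ {c y xs c′} → Blist c y xs (bok c′) → BInv c →
                  BInv c′ × MarksGrow c c′ × NewInB c c′
    Blist-grows blist-nil inv = inv , (λ _ marked-z → marked-z) , inj₁
    Blist-grows {c} {c′ = c′} (blist-ok {c' = c₁} t l) inv with Btraverse-grows t inv
    ... | inv₁ , grows₁ , new₁ with Blist-grows l inv₁
    ...   | inv₂ , grows₂ , new₂ = inv₂ , (λ z → grows₂ z ∘ grows₁ z) , new
      where
        new : NewInB c c′
        new z∈ with new₂ z∈
        ... | inj₁ z∈B₁ = new₁ z∈B₁
        ... | inj₂ unmarked₁ = inj₂ (unmarked-before {c} {c₁} grows₁ unmarked₁)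

    Btraverse-grows : ∀ {c x y c′} → Btraverse c x y (bok c′) → BInv c →
                      BInv c′ × MarksGrow c c′ × NewInB c c′
    Btraverse-grows (btrav-marked _ _ _) inv = inv , (λ _ marked-z → marked-z) , inj₁
    Btraverse-grows {c} {c′ = c′} (btrav-visit x≢w _ unmarked b) inv
      with Bvisit-grows b inv (unmarked-∉B {c} inv unmarked) x≢w
    ... | inv′ , grows , new = inv′ , grows , new′
      where
        new′ : NewInB c c′
        new′ z∈ with new z∈
        ... | inj₁ refl = inj₂ unmarked
        ... | inj₂ z-new = z-new

  FInv : Config n → Set
  FInv c = Unique (F c) × All (λ z → lvl c z ≡ lvl c w) (F c) × All (_∉ B c) (F c)

  record ForwardStep (c c′ : Config n) : Set where
    field
      F-inv         : FInv c′
      lvl-w         : lvl c′ w ≡ lvl c w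
      B-same        : B c′ ≡ B c
      indexing-same : indexing c′ ≡ indexing c
      lifted        : ∀ z → lvl c′ z ≡ lvl c z ⊎ lvl c′ z ≡ lvl c w

  NewInF : Config n → Config n → Set
  NewInF c c′ = ∀ {z} → z ∈ F c′ → z ∈ F c ⊎ lvl c z < lvl c w

  ForwardStep-refl : ∀ {c} → FInv c → ForwardStep c c
  ForwardStep-refl inv = record
    { F-inv = inv ; lvl-w = refl ; B-same = refl ; indexing-same = refl ; lifted = λ _ → inj₁ refl }

  ForwardStep-trans : ∀ {c c₁ c₂} → ForwardStep c c₁ → ForwardStep c₁ c₂ → ForwardStep c c₂
  ForwardStep-trans {c} {c₁} {c₂} s₁ s₂ = record
    { F-inv         = F-inv s₂
    ; lvl-w         = trans (lvl-w s₂) (lvl-w s₁)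
    ; B-same        = trans (B-same s₂) (B-same s₁)
    ; indexing-same = trans (indexing-same s₂) (indexing-same s₁)
    ; lifted        = lifted′
    }
    where
      open ForwardStep
      lifted′ : ∀ z → lvl c₂ z ≡ lvl c z ⊎ lvl c₂ z ≡ lvl c w
      lifted′ z with lifted s₂ z | lifted s₁ z
      ... | inj₂ e₂ | _       = inj₂ (trans e₂ (lvl-w s₁))
      ... | inj₁ e₂ | inj₁ e₁ = inj₁ (trans e₂ e₁)
      ... | inj₁ e₂ | inj₂ e₁ = inj₂ (trans e₂ e₁)

  below-before : ∀ {c c′ z} → ForwardStep c c′ → lvl c′ z < lvl c′ w → lvl c z < lvl c w
  below-before {z = z} s below with ForwardStep.lifted s z
  ... | inj₁ e = subst₂ _<_ e (ForwardStep.lvl-w s) below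
  ... | inj₂ e = contradiction (trans e (sym (ForwardStep.lvl-w s))) (ℕ.<⇒≢ below)

  NewInF-trans : ∀ {c c₁ c₂} → ForwardStep c c₁ → NewInF c c₁ → NewInF c₁ c₂ → NewInF c c₂
  NewInF-trans s₁ new₁ new₂ z∈ with new₂ z∈
  ... | inj₁ z∈F₁ = new₁ z∈F₁
  ... | inj₂ below = inj₂ (below-before s₁ below)

  addIn-step : ∀ {c c′} x y → ForwardStep c c′ × NewInF c c′ →
               ForwardStep c (addIn c′ x y) × NewInF c (addIn c′ x y)
  addIn-step {c′ = c′} x y (s , new) with does (lvl c′ y ℕ.≟ lvl c′ w)
  ... | true  = record { ForwardStep s } , new
  ... | false = s , new

  raise-step : ∀ {c y} → lvl c y < lvl c w → FInv c → ForwardStep c (raise c y)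
  raise-step {c} {y} below (unique , at-w , ∉B) = record
    { F-inv         = unique , All.map still-at-w at-w , ∉B
    ; lvl-w         = lvl-w
    ; B-same        = refl
    ; indexing-same = refl
    ; lifted        = lifted
    }
    where
      ≢y : ∀ {z} → lvl c z ≡ lvl c w → z ≢ y
      ≢y at-w-z refl = ℕ.<⇒≢ below at-w-z
      lvl-w : upd (lvl c) y (lvl c w) w ≡ lvl c w
      lvl-w = upd-other (lvl c) y _ (≢y refl)
      still-at-w : ∀ {z} → lvl c z ≡ lvl c w → upd (lvl c) y (lvl c w) z ≡ upd (lvl c) y (lvl c w) w
      still-at-w at-w-z = trans (upd-other (lvl c) y _ (≢y at-w-z)) (trans at-w-z (sym lvl-w))
      lifted : ∀ z → upd (lvl c) y (lvl c w) z ≡ lvl c z ⊎ upd (lvl c) y (lvl c w) z ≡ lvl c w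
      lifted z with z ≟ y
      ... | yes _ = inj₂ refl
      ... | no _ = inj₁ refl

  mutual
    Fvisit-step : ∀ {c x c′} → Fvisit c x (fok c′) → FInv c → x ∉ F c → x ∉ B c → lvl c x ≡ lvl c w →
                  ForwardStep c c′ × (∀ {z} → z ∈ F c′ → z ≡ x ⊎ z ∈ F c ⊎ lvl c z < lvl c w)
    Fvisit-step {c} {x} (fvisit-ok {c' = c″} _ l) inv x∉F x∉B x-at-w with Flist-step l inv
    ... | s , new = record { ForwardStep s hiding (F-inv) ; F-inv = F-inv′ } , new′
      where
        open ForwardStep s
        x∉F″ : x ∉ F c″
        x∉F″ x∈F″ with new x∈F″
        ... | inj₁ x∈F = x∉F x∈F
        ... | inj₂ below = ℕ.<⇒≢ below x-at-w
        x-at-w″ : lvl c″ x ≡ lvl c″ w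
        x-at-w″ with lifted x
        ... | inj₁ e = trans e (trans x-at-w (sym lvl-w))
        ... | inj₂ e = trans e (sym lvl-w)
        F-inv′ : FInv (pushF c″ x)
        F-inv′ = let (unique , at-w , ∉B) = F-inv in
          All.tabulate (λ z∈ x≡z → x∉F″ (subst (_∈ F c″) (sym x≡z) z∈)) ∷ unique ,
          x-at-w″ ∷ at-w ,
          subst (x ∉_) (sym B-same) x∉B ∷ ∉B
        new′ : ∀ {z} → z ∈ x ∷ F c″ → z ≡ x ⊎ z ∈ F c ⊎ lvl c z < lvl c w
        new′ (here z≡x) = inj₁ z≡x
        new′ (there z∈) = inj₂ (new z∈)

    Flist-step : ∀ {c x ys c′} → Flist c x ys (fok c′) → FInv c → ForwardStep c c′ × NewInF c c′
    Flist-step flist-nil inv = ForwardStep-refl inv , inj₁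
    Flist-step {c′ = c′} (flist-ok {c' = c₁} t l) inv with Ftraverse-step t inv
    ... | s₁ , new₁ with Flist-step l (ForwardStep.F-inv {c′ = c₁} s₁)
    ...   | s₂ , new₂ = ForwardStep-trans s₁ s₂ , NewInF-trans {c₂ = c′} s₁ new₁ new₂

    Ftraverse-step : ∀ {c x y c′} → Ftraverse c x y (fok c′) → FInv c → ForwardStep c c′ × NewInF c c′
    Ftraverse-step {x = x} {y} (ftrav-high _ _) inv = addIn-step x y (ForwardStep-refl inv , inj₁)
    Ftraverse-step {c} {x} {y} (ftrav-low-ok {c' = c′} y∉ below visit) inv@(_ , at-w , _)
      with raise-step {c} {y} below inv
    ... | s₁ with Fvisit-step visit (ForwardStep.F-inv s₁) y∉F (y∉ ∘ inj₂) y-at-w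
      where
        y∉F : y ∉ F c
        y∉F y∈F = ℕ.<⇒≢ below (All.lookup at-w y∈F)
        y-at-w : lvl (raise c y) y ≡ lvl (raise c y) w
        y-at-w = trans (upd-same (lvl c) y _) (sym (ForwardStep.lvl-w s₁))
    ...   | s₂ , new₂ = addIn-step x y (ForwardStep-trans s₁ s₂ , new)
      where
        new : NewInF c c′
        new z∈ with new₂ z∈
        ... | inj₁ refl = inj₂ below
        ... | inj₂ (inj₁ z∈F) = inj₁ z∈F
        ... | inj₂ (inj₂ below₁) = inj₂ (below-before s₁ below₁)

  forward-outcome : ∀ {c c′} → Fvisit c w (fok c′) → F c ≡ [] → Unique (B c) → w ∉ B c →
                    SearchOutcome c c′
  forward-outcome {c} visit F≡[] unique w∉B
    with Fvisit-step visit inv (subst (w ∉_) (sym F≡[]) λ ()) w∉B refl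
    where
      inv : FInv c
      inv = subst (λ l → Unique l × All _ l × All _ l) (sym F≡[]) ([] , [] , [])
  ... | s , _ =
    indexing-same ,
    Unique.++⁺ (subst Unique (sym B-same) unique) F-unique (λ (z∈B , z∈F) → All.lookup ∉B z∈F z∈B)
    where
      open ForwardStep s
      F-unique = proj₁ F-inv
      ∉B = proj₂ (proj₂ F-inv)

  backward-outcome : ∀ {c c′} → Bvisit (startSearch c) v (bok c′) → v ≢ w → SearchOutcome c c′
  backward-outcome back v≢w with Bvisit-frame back | Bvisit-grows back ([] , [] , []) (λ ()) v≢w
  ... | same , F≡[] | (unique , _) , _ =
    same , subst (λ l → Unique (_ ++ l)) (sym F≡[]) (subst Unique (sym (List.++-identityʳ _)) unique)

  insert-floored : ∀ {c c′} → Insert v w c (done c′) → v ≢ w → Floored c →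
                   Floored c′ × index c - + n ≤ index c′
  insert-floored (step1-skip _) _ floored = floored , ℤ.i-j≤i _ (+ n)
  insert-floored {c} (step2-same _ back _) v≢w = step4-floored (backward-outcome {c} back v≢w)
  insert-floored {c} (step2-abort _ back (s3-ok fwd)) _ with Bvisit-frame back
  ... | same , F≡[] , B≡[] =
    step4-floored (SearchOutcome-trans {c} same (forward-outcome fwd F≡[] B-unique w∉B))
    where
      B-unique = subst Unique (sym B≡[]) []
      w∉B = subst (w ∉_) (sym B≡[]) λ ()
  insert-floored {c} (step2-differ _ back _ (s3-ok fwd)) v≢w
    with Bvisit-frame back | Bvisit-grows back ([] , [] , []) (λ ()) v≢w
  ... | same , F≡[] | (unique , _ , ≢w) , _ =
    step4-floored (SearchOutcome-trans {c} same (forward-outcome fwd F≡[] unique w∉B))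
    where
      w∉B = λ w∈B → All.lookup ≢w w∈B refl

module _ (n m : ℕ) where
  open Algorithm n m

  Run-floored : ∀ {c es c″} → Run c es c″ → All (λ e → proj₁ e ≢ proj₂ e) es → Floored c →
                Floored c″ × index c - + (length es * n) ≤ index c″
  Run-floored {c} run-nil [] floored = floored , ℤ.≤-reflexive (ℤ.+-identityʳ (index c))
  Run-floored {c} (run-cycle _) _ floored = floored , ℤ.i-j≤i (index c) _
  Run-floored {c} {_ ∷ es} {c″} (run-step {c' = c′} {v = v} {w = w} ins run) (v≢w ∷ distinct) floored
    with Search.insert-floored n m v w ins v≢w floored
  ... | floored′ , step with Run-floored run distinct floored′
  ...   | floored″ , steps = floored″ , (begin
    index c - + (n + length es * n)      ≡⟨ i-[j+k]≡i-j-k (index c) n (length es * n) ⟩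
    index c - + n - + (length es * n)    ≤⟨ ℤ.+-monoˡ-≤ (- + (length es * n)) step ⟩
    index c′ - + (length es * n)         ≤⟨ steps ⟩
    index c″                             ∎)
    where open ℤ.≤-Reasoning

lemma2 : (n m : ℕ) → 1 < n →
    (es : List (Fin n × Fin n)) → length es ≡ m →
    All (λ e → proj₁ e ≢ proj₂ e) es → Unique es →
    (i0 : Fin n → ℤ) → Injective _≡_ _≡_ i0 →
    (∀ x → - (+ n) ≤ i0 x × i0 x ≤ - (+ 1)) →
    (c : Config n) → Algorithm.Run n m (initConfig n i0) es c →
    (∀ x → - (+ (n * m + n)) ≤ idx c x) × All (λ j → - (+ (n * m + n)) ≤ j) (log c)
-- Neither n > 1, nor the distinctness of the arcs or of the initial indices, nor
-- i0 ≤ -1 is needed for the bound.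
lemma2 n m _ es refl distinct _ i0 _ i0-range c run = ≤ᵢ-weaken {c = c} bound floored
  where
    initially-floored : Floored (initConfig n i0)
    initially-floored = (λ x → proj₁ (i0-range x)) , []
    floored×bound = Run-floored n m run distinct initially-floored
    floored = proj₁ floored×bound
    bound : - (+ (n * m + n)) ≤ index c
    bound = begin
      - (+ (n * m + n))      ≡⟨ cong (λ k → - + k) nm+n≡n+mn ⟩
      - (+ (n + m * n))      ≡⟨ cong -_ (ℤ.pos-+ n (m * n)) ⟩
      - (+ n ℤ.+ + (m * n))  ≡⟨ ℤ.neg-distrib-+ (+ n) (+ (m * n)) ⟩
      - (+ n) - + (m * n)    ≤⟨ proj₂ floored×bound ⟩
      index c                ∎
      where
        open ℤ.≤-Reasoning
        nm+n≡n+mn : n * m + n ≡ n + m * n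
        nm+n≡n+mn = trans (ℕ.+-comm (n * m) n) (cong (λ k → n + k) (ℕ.*-comm n m))
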